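{- (1) Every SJ-tree is described by some SJ-scheme. (2) Every SJ-scheme describes an SJ-tree, which is unique up to isomorphism.
   Context: All sets are finite or countable. A join-tree is $(N,\leq)$ with $\leq$ a partial order on a countable set such that each $\{y\mid y\geq x\}$ is linearly ordered and every two nodes have a join. A line is a linearly ordered convex subset; the top $\widehat X$ of nonempty $X$ is its least strict upper bound if it exists. A structuring of a join-tree is a set $\mathcal U$ of nonempty lines partitioning $N$ such that exactly one $A\in\mathcal U$ (the axis) is upwards closed, every other $U\in\mathcal U$ has a top, and for every $x$ the sequence $y_0=x$, $y_{i+1}=\widehat{U(y_i)}$ ($U(y)$ the line containing $y$, stopping when $U(y_i)=A$) is finite. $(N,\leq,\mathcal U)$ is then an SJ-tree; isomorphisms of SJ-trees are order isomorphisms mapping lines onto lines. For $x\in N$, $\mathcal U^x$ is the set of $U\in\mathcal U$ with $\widehat U=x$. An arrangement over $X$ is $(V,\leq,lab)$, $(V,\leq)$ a countable linear order, $lab:V\to X$, with label-preserving order isomorphisms; $(W,\leq,r)$ denotes a subset $W$ with restricted order and labelling $r$. A $D$-labelled set is $(M,lab)$ with $lab:M\to D$, with label-preserving bijections as isomorphisms. An SJ-scheme is $\Delta=(Q,D,w_{Ax},(m_q)_{q\in Q},(w_d)_{d\in D})$ where $Q,D$ are sets, $w_{Ax}$ and the $w_d$ are arrangements over $Q$ and each $m_q$ is a $D$-labelled set. $\Delta$ describes an SJ-tree $(N,\leq,\mathcal U)$ with axis $A$ if there are maps $r:N\to Q$ and $\tilde r:\mathcal U\setminus\{A\}\to D$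 such that $(A,\leq,r)\simeq w_{Ax}$, for each $x\in N$ the $D$-labelled set $(\mathcal U^x,\tilde r)$ is isomorphic to $m_{r(x)}$, and for each $U\in\mathcal U\setminus\{A\}$, $(U,\leq,r)\simeq w_{\tilde r(U)}$. -}

module Defs where

open import Data.Nat using (ℕ)
open import Data.Maybe using (Maybe; just; nothing)
open import Data.Product using (Σ; _×_; _,_; proj₁; proj₂)
open import Data.Sum using (_⊎_)
open import Relation.Nullary using (¬_)
open import Relation.Binary.PropositionalEquality using (_≡_; _≢_)
open import Relation.Binary.Structures using (IsPartialOrder; IsTotalOrder)
open import Function.Bundles using (_↣_; _↔_; Inverse)

-- "All sets are finite or countable": an injection into ℕ.

Countable : Set → Set
Countable A = A ↣ ℕ

record JoinTree : Set₁ where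
  field
    N              : Set
    countable      : Countable N
    _≤_            : N → N → Set
    isPartialOrder : IsPartialOrder _≡_ _≤_
    upLinear       : ∀ x y z → x ≤ y → x ≤ z → (y ≤ z) ⊎ (z ≤ y)
    join           : ∀ x y → Σ N λ j → (x ≤ j) × (y ≤ j) × (∀ z → x ≤ z → y ≤ z → j ≤ z)

module _ (T : JoinTree) where
  open JoinTree T

  _<_ : N → N → Set
  x < y = (x ≤ y) × (x ≢ y)

  IsLinear : (N → Set) → Set
  IsLinear P = ∀ x y → P x → P y → (x ≤ y) ⊎ (y ≤ x)

  IsConvex : (N → Set) → Set
  IsConvex P = ∀ x y z → P x → P z → x ≤ y → y ≤ z → P y

  UpClosed : (N → Set) → Set
  UpClosed P = ∀ x y → P x → x ≤ y → P y

  IsTop : (N → Set) → N → Set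
  IsTop P t = (∀ y → P y → y < t) × (∀ t' → (∀ y → P y → y < t') → t ≤ t')

  -- the sequence y₀ = x, y_{i+1} = top of the line of y_i, stopping at the
  -- axis, is finite.  Lines are indexed by  Maybe L , the axis being  nothing .
  data ReachesAxis {L : Set} (line : N → Maybe L) : N → Set where
    here : ∀ {x} → line x ≡ nothing → ReachesAxis line x
    step : ∀ {x t} {U : L} → line x ≡ just U →
           IsTop (λ y → line y ≡ just U) t → ReachesAxis line t → ReachesAxis line x

-- The set 𝒰 of lines partitioning N is represented by a map
-- line : N → Maybe L  sending each node to the line containing it; the axis
-- is  nothing , the other lines are indexed by L.  The top of each non-axis line (unique when it
-- exists) is recorded by  top .

record Structuring (T : JoinTree) : Set₁ where
  open JoinTree T
  field
    L              : Set
    countableL     : Countable L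
    line           : N → Maybe L
  InLine : Maybe L → N → Set
  InLine U x = line x ≡ U
  field
    nonempty       : ∀ U → Σ N (InLine U)
    linear         : ∀ U → IsLinear T (InLine U)
    convex         : ∀ U → IsConvex T (InLine U)
    axis-up        : UpClosed T (InLine nothing)
    axis-unique    : ∀ (U : L) → ¬ UpClosed T (InLine (just U))
    top            : L → N
    top-isTop      : ∀ U → IsTop T (InLine (just U)) (top U)
    finite         : ∀ x → ReachesAxis T line x

record SJTree : Set₁ where
  field
    tree        : JoinTree
    structuring : Structuring tree
  open JoinTree tree public
  open Structuring structuring public

SJIso : SJTree → SJTree → Set
SJIso S S' =
  Σ (S.N ↔ S'.N) λ f →
    (∀ x y → (S._≤_ x y → S'._≤_ (Inverse.to f x) (Inverse.to f y))
           × (S'._≤_ (Inverse.to f x) (Inverse.to f y) → S._≤_ x y))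
  × (∀ x y → (S.line x ≡ S.line y → S'.line (Inverse.to f x) ≡ S'.line (Inverse.to f y))
           × (S'.line (Inverse.to f x) ≡ S'.line (Inverse.to f y) → S.line x ≡ S.line y))
  where
    module S = SJTree S
    module S' = SJTree S'

record Arrangement (X : Set) : Set₁ where
  field
    V            : Set
    countable    : Countable V
    _≤_          : V → V → Set
    isTotalOrder : IsTotalOrder _≡_ _≤_
    lab          : V → X

-- (W, ≤, r) ≃ w, where W ⊆ N is a predicate, ≤ is restricted to W and
-- r is the labelling: a label-preserving order isomorphism.
SubArrIso : {X : Set} (N : Set) (_≤_ : N → N → Set) (W : N → Set)
            (r : N → X) (w : Arrangement X) → Set
SubArrIso N _≤_ W r w =
  Σ (Σ N W ↔ A.V) λ f →
    (∀ x y → (proj₁ x ≤ proj₁ y → A._≤_ (Inverse.to f x) (Inverse.to f y))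
           × (A._≤_ (Inverse.to f x) (Inverse.to f y) → proj₁ x ≤ proj₁ y))
  × (∀ x → A.lab (Inverse.to f x) ≡ r (proj₁ x))
  where module A = Arrangement w

record LabelledSet (D : Set) : Set₁ where
  field
    M         : Set
    countable : Countable M
    lab       : M → D

LabIso : {D : Set} (M : Set) (lab : M → D) (m : LabelledSet D) → Set
LabIso M lab m =
  Σ (M ↔ LabelledSet.M m) λ f → ∀ x → LabelledSet.lab m (Inverse.to f x) ≡ lab x

record SJScheme : Set₁ where
  field
    Q    : Set
    countableQ : Countable Q
    D    : Set
    countableD : Countable D
    wAx  : Arrangement Q
    m    : Q → LabelledSet D
    w    : D → Arrangement Q

Describes : SJScheme → SJTree → Set
Describes Δ S =
  Σ (S.N → Δ.Q) λ r → Σ (S.L → Δ.D) λ r~ →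
      SubArrIso S.N S._≤_ (S.InLine nothing) r Δ.wAx
    × (∀ x → LabIso (Σ S.L λ U → S.top U ≡ x) (λ u → r~ (proj₁ u)) (Δ.m (r x)))
    × (∀ U → SubArrIso S.N S._≤_ (S.InLine (just U)) r (Δ.w (r~ U)))
  where
    module S = SJTree S
    module Δ = SJScheme Δ

-- Lines are nonempty, so a scheme can only describe a tree if the arrangements
-- it uses are nonempty: w_Ax, and w_d for every label d occurring in some m_q.
NonemptyArrangements : SJScheme → Set
NonemptyArrangements Δ =
  Arrangement.V Δ.wAx
  × (∀ q (e : LabelledSet.M (Δ.m q)) → Arrangement.V (Δ.w (LabelledSet.lab (Δ.m q) e)))
  where module Δ = SJScheme Δ

-- (1) A structured tree is described by its own scheme: the labels are the nodes, the line
-- labels are the lines, w_Ax and w_U are the axis and the line U, and m_x lists the lines with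
-- top x.
-- (2) A scheme Δ unfolds into a canonical tree whose nodes are the finite paths
--   v₀, (e₁, v₁), …, (eₖ, vₖ)
-- with v₀ ∈ w_Ax, eᵢ₊₁ ∈ m of the label of vᵢ and vᵢ₊₁ ∈ w of the label of eᵢ₊₁; the last step
-- is the position of the node on its line and the path without it is the top of that line.
-- If Δ describes a tree S, the description isomorphisms define, by recursion on paths, a map
-- into S that preserves and reflects the order and the lines.  It is onto because every node
-- of S reaches the axis after finitely many passages to the top of its line, so all trees
-- described by Δ are isomorphic to the canonical one.
module Submission where

open import Defs
open import Data.Nat as ℕ using (ℕ; zero; suc; _+_; z≤n; s≤s)
import Data.Nat.Properties as ℕₚ
open import Data.Maybe using (Maybe; just; nothing)
open import Data.Maybe.Properties using (just-injective; ≡-dec)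
open import Data.Product using (Σ; _×_; _,_; proj₁; proj₂)
open import Data.Sum using (_⊎_; inj₁; inj₂)
open import Data.Empty using (⊥-elim)
open import Function using (_∘_)
open import Relation.Nullary using (¬_; Dec; yes; no)
open import Relation.Binary using (tri<; tri≈; tri>)
open import Relation.Binary.Structures using (IsPartialOrder; IsTotalOrder)
open import Relation.Binary.PropositionalEquality
  using (_≡_; _≢_; refl; sym; trans; cong; subst; subst₂; isEquivalence; module ≡-Reasoning)
open import Function.Bundles using (_↔_; Inverse; Injection; mk↣; mk↔ₛ′)
open import Function.Properties.Inverse using (↔-refl; ↔-sym; ↔-trans)
open import Axiom.UniquenessOfIdentityProofs.WithK using (uip)

triangle : ℕ → ℕ
triangle zero    = zero
triangle (suc n) = suc n + triangle n

triangle-mono-≤ : ∀ {m n} → m ℕ.≤ n → triangle m ℕ.≤ triangle n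
triangle-mono-≤ z≤n     = z≤n
triangle-mono-≤ (s≤s p) = ℕₚ.+-mono-≤ (s≤s p) (triangle-mono-≤ p)

-- Diagonal s occupies the codes triangle s, …, triangle s + s; the next starts at triangle (suc s).
triangle+-<-next-diagonal : ∀ s a s' a' → s ℕ.< s' → a ℕ.≤ s → triangle s + a ℕ.< triangle s' + a'
triangle+-<-next-diagonal s a s' a' s<s' a≤s = begin-strict
  triangle s + a       <⟨ ℕₚ.+-monoʳ-< (triangle s) (s≤s a≤s) ⟩
  triangle s + suc s   ≡⟨ ℕₚ.+-comm (triangle s) (suc s) ⟩
  triangle (suc s)     ≤⟨ triangle-mono-≤ s<s' ⟩
  triangle s'          ≤⟨ ℕₚ.m≤m+n (triangle s') a' ⟩
  triangle s' + a'     ∎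
  where open ℕₚ.≤-Reasoning

-- Abstract, so that equations between codes are inverted by pair-injective rather than by unfolding.
abstract
  pair : ℕ → ℕ → ℕ
  pair a b = triangle (a + b) + a

  pair-injective : ∀ {a b a' b'} → pair a b ≡ pair a' b' → a ≡ a' × b ≡ b'
  pair-injective {a} {b} {a'} {b'} eq with ℕₚ.<-cmp (a + b) (a' + b')
  ... | tri< lt _ _ =
    ⊥-elim (ℕₚ.<-irrefl eq (triangle+-<-next-diagonal _ a _ a' lt (ℕₚ.m≤m+n a b)))
  ... | tri> _ _ gt =
    ⊥-elim (ℕₚ.<-irrefl (sym eq) (triangle+-<-next-diagonal _ a' _ a gt (ℕₚ.m≤m+n a' b')))
  ... | tri≈ _ s≡s' _ = a≡a' , ℕₚ.+-cancelˡ-≡ a b b' (trans s≡s' (cong (_+ b') (sym a≡a')))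
    where
    a≡a' : a ≡ a'
    a≡a' = ℕₚ.+-cancelˡ-≡ (triangle (a + b)) a a'
             (trans eq (cong (λ s → triangle s + a') (sym s≡s')))

proj₁-injective : {A B : Set} {f : A → B} {b : B} {x y : Σ A λ a → f a ≡ b} →
                  proj₁ x ≡ proj₁ y → x ≡ y
proj₁-injective {x = a , p} {.a , q} refl = cong (a ,_) (uip p q)

fibre-countable : {A B : Set} {f : A → B} {b : B} → Countable A → Countable (Σ A λ a → f a ≡ b)
fibre-countable c = mk↣ (proj₁-injective ∘ Injection.injective c)

module Enumeration {A B C : Set} {g : A → C} {c : C} (f : (Σ A λ a → g a ≡ c) ↔ B) where
  open Inverse f

  elem : B → A
  elem b = proj₁ (from b)

  elem-∈ : ∀ b → g (elem b) ≡ c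
  elem-∈ b = proj₂ (from b)

  elem-injective : ∀ {b b'} → elem b ≡ elem b' → b ≡ b'
  elem-injective {b} {b'} eq = begin
    b                 ≡⟨ sym (strictlyInverseˡ b) ⟩
    to (from b)       ≡⟨ cong to (proj₁-injective eq) ⟩
    to (from b')      ≡⟨ strictlyInverseˡ b' ⟩
    b'                ∎
    where open ≡-Reasoning

  elem-surjective : ∀ {a} → g a ≡ c → Σ B λ b → elem b ≡ a
  elem-surjective {a} ga≡c = to (a , ga≡c) , cong proj₁ (strictlyInverseʳ (a , ga≡c))

module SubArrIsoEnumeration {X N C : Set} {_≤_ : N → N → Set} {g : N → C} {c : C} {r : N → X}
                            {w : Arrangement X} (iso : SubArrIso N _≤_ (λ x → g x ≡ c) r w) where
  private module A = Arrangement w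
  open Inverse (proj₁ iso)

  open Enumeration (proj₁ iso) public

  elem-label : ∀ v → r (elem v) ≡ A.lab v
  elem-label v = trans (sym (proj₂ (proj₂ iso) (from v))) (cong A.lab (strictlyInverseˡ v))

  elem-≤ : ∀ v v' → (elem v ≤ elem v' → A._≤_ v v') × (A._≤_ v v' → elem v ≤ elem v')
  elem-≤ v v' with proj₁ (proj₂ iso) (from v) (from v')
  ... | to-≤ , from-≤ =
      (λ h → subst₂ A._≤_ (strictlyInverseˡ v) (strictlyInverseˡ v') (to-≤ h))
    , (λ h → from-≤ (subst₂ A._≤_ (sym (strictlyInverseˡ v)) (sym (strictlyInverseˡ v')) h))

module LabIsoEnumeration {A C D : Set} {g : A → C} {c : C} {lab : A → D} {m : LabelledSet D}
                         (iso : LabIso (Σ A λ a → g a ≡ c) (lab ∘ proj₁) m) where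
  open Inverse (proj₁ iso)

  open Enumeration (proj₁ iso) public

  elem-label : ∀ e → lab (elem e) ≡ LabelledSet.lab m e
  elem-label e = trans (sym (proj₂ iso (from e))) (cong (LabelledSet.lab m) (strictlyInverseˡ e))

Embeds : {A B : Set} → A ↔ B → (A → A → Set) → (B → B → Set) → Set
Embeds f R R' = ∀ x y → (R x y → R' (Inverse.to f x) (Inverse.to f y))
                      × (R' (Inverse.to f x) (Inverse.to f y) → R x y)

embeds-sym : {A B : Set} (f : A ↔ B) {R : A → A → Set} {R' : B → B → Set} →
             Embeds f R R' → Embeds (↔-sym f) R' R
embeds-sym f {R' = R'} e x y =
    (λ h → proj₂ (e _ _) (subst₂ R' (sym (strictlyInverseˡ x)) (sym (strictlyInverseˡ y)) h))
  , (λ h → subst₂ R' (strictlyInverseˡ x) (strictlyInverseˡ y) (proj₁ (e _ _) h))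
  where open Inverse f

embeds-trans : {A B C : Set} (f : A ↔ B) (g : B ↔ C)
               {R : A → A → Set} {R' : B → B → Set} {R'' : C → C → Set} →
               Embeds f R R' → Embeds g R' R'' → Embeds (↔-trans f g) R R''
embeds-trans f g e e' x y =
  (proj₁ (e' _ _) ∘ proj₁ (e x y)) , (proj₂ (e x y) ∘ proj₂ (e' _ _))

SJIso-sym : ∀ S S' → SJIso S S' → SJIso S' S
SJIso-sym S S' (f , ≤-emb , line-emb) =
    ↔-sym f
  , embeds-sym f {S._≤_} {S'._≤_} ≤-emb
  , embeds-sym f {λ x y → S.line x ≡ S.line y} {λ x y → S'.line x ≡ S'.line y} line-emb
  where
  module S = SJTree S
  module S' = SJTree S'

SJIso-trans : ∀ S S' S'' → SJIso S S' → SJIso S' S'' → SJIso S S''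
SJIso-trans S S' S'' (f , ≤-emb , line-emb) (g , ≤-emb' , line-emb') =
    ↔-trans f g
  , embeds-trans f g {S._≤_} {S'._≤_} {S''._≤_} ≤-emb ≤-emb'
  , embeds-trans f g {λ x y → S.line x ≡ S.line y} {λ x y → S'.line x ≡ S'.line y}
                     {λ x y → S''.line x ≡ S''.line y} line-emb line-emb'
  where
  module S = SJTree S
  module S' = SJTree S'
  module S'' = SJTree S''

top-unique : (T : JoinTree) {P : JoinTree.N T → Set} {t t' : JoinTree.N T} →
             IsTop T P t → IsTop T P t' → t ≡ t'
top-unique T t-top t'-top = antisym (proj₂ t-top _ (proj₁ t'-top)) (proj₂ t'-top _ (proj₁ t-top))
  where open IsPartialOrder (JoinTree.isPartialOrder T)

module _ (S : SJTree) where
  open SJTree S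
  open IsPartialOrder isPartialOrder using () renaming (trans to ≤-trans)

  -- If y is not on the line U of x ≤ y, every node of U is below y (by linearity of U and of
  -- the nodes above x, and convexity of U), so the top of U is below y.
  ≤-sameLine-or-top≤ : ∀ x y → x ≤ y →
                       line x ≡ line y ⊎ Σ L λ U → line x ≡ just U × top U ≤ y
  ≤-sameLine-or-top≤ x y x≤y with line x in x∈U
  ... | nothing = inj₁ (sym (axis-up x y x∈U x≤y))
  ... | just U with ≡-dec (ℕₚ.eq? countableL) (line y) (just U)
  ...   | yes y∈U = inj₁ (sym y∈U)
  ...   | no y∉U = inj₂ (U , refl , proj₂ (top-isTop U) y U-below-y)
    where
    U-below-y : ∀ u → line u ≡ just U → (u ≤ y) × (u ≢ y)
    U-below-y u u∈U = u≤y , λ { refl → y∉U u∈U }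
      where
      u≤y : u ≤ y
      u≤y with linear (just U) u x u∈U x∈U
      ... | inj₁ u≤x = ≤-trans u≤x x≤y
      ... | inj₂ x≤u with upLinear x u y x≤u x≤y
      ...   | inj₁ u≤y = u≤y
      ...   | inj₂ y≤u = ⊥-elim (y∉U (convex (just U) x y u x∈U u∈U x≤y y≤u))

module OwnScheme (S : SJTree) where
  open SJTree S
  open IsPartialOrder isPartialOrder using (antisym) renaming (refl to ≤-refl; trans to ≤-trans)

  lineArrangement : Maybe L → Arrangement N
  lineArrangement U = record
    { V            = Σ N (InLine U)
    ; countable    = fibre-countable countable
    ; _≤_          = λ x y → proj₁ x ≤ proj₁ y
    ; isTotalOrder = record
      { isPartialOrder = record
        { isPreorder = record
          { isEquivalence = isEquivalence
          ; reflexive     = λ { refl → ≤-refl }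
          ; trans         = ≤-trans
          }
        ; antisym = λ x≤y y≤x → proj₁-injective (antisym x≤y y≤x)
        }
      ; total = λ x y → linear U _ _ (proj₂ x) (proj₂ y)
      }
    ; lab          = proj₁
    }

  scheme : SJScheme
  scheme = record
    { Q          = N
    ; countableQ = countable
    ; D          = L
    ; countableD = countableL
    ; wAx        = lineArrangement nothing
    ; m          = λ x → record
                     { M = Σ L λ U → top U ≡ x ; countable = fibre-countable countableL ; lab = proj₁ }
    ; w          = lineArrangement ∘ just
    }

  describes : Describes scheme S
  describes =
      (λ x → x) , (λ U → U)
    , (↔-refl , (λ _ _ → (λ h → h) , (λ h → h)) , (λ _ → refl))
    , (λ _ → ↔-refl , (λ _ → refl))
    , (λ _ → ↔-refl , (λ _ _ → (λ h → h) , (λ h → h)) , (λ _ → refl))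

module CanonicalTree (Δ : SJScheme) (nonempty-arrangements : NonemptyArrangements Δ) where
  open SJScheme Δ
  module A = Arrangement wAx
  module W (d : D) = Arrangement (w d)
  module M (q : Q) = LabelledSet (m q)
  private
    module AT = IsTotalOrder A.isTotalOrder
    module WT (d : D) = IsTotalOrder (W.isTotalOrder d)

  mutual
    data Node : Set where
      onAxis : A.V → Node
      onLine : (p : Node) (e : M.M (label p)) → W.V (M.lab (label p) e) → Node

    label : Node → Q
    label (onAxis v)     = A.lab v
    label (onLine p e v) = W.lab _ v

  -- A non-axis line is named by its top p and the element of m (label p) it realises.
  Line : Set
  Line = Σ Node λ p → M.M (label p)

  lineLabel : Line → D
  lineLabel (p , e) = M.lab (label p) e

  line : Node → Maybe Line
  line (onAxis _)     = nothing
  line (onLine p e _) = just (p , e)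

  depth : Node → ℕ
  depth (onAxis _)     = zero
  depth (onLine p _ _) = suc (depth p)

  data _⊑_ : Node → Node → Set where
    axis≤ : ∀ {v v'} → A._≤_ v v' → onAxis v ⊑ onAxis v'
    line≤ : ∀ {p e v v'} → W._≤_ (M.lab (label p) e) v v' → onLine p e v ⊑ onLine p e v'
    up    : ∀ {p e v y} → p ⊑ y → onLine p e v ⊑ y

  ⊑-refl : ∀ {x} → x ⊑ x
  ⊑-refl {onAxis _}     = axis≤ AT.refl
  ⊑-refl {onLine _ _ _} = line≤ (WT.refl _)

  ⊑-trans : ∀ {x y z} → x ⊑ y → y ⊑ z → x ⊑ z
  ⊑-trans (axis≤ a) (axis≤ b) = axis≤ (AT.trans a b)
  ⊑-trans (line≤ a) (line≤ b) = line≤ (WT.trans _ a b)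
  ⊑-trans (line≤ _) (up b)    = up b
  ⊑-trans (up a)    b         = up (⊑-trans a b)

  depth-antitone : ∀ {x y} → x ⊑ y → depth y ℕ.≤ depth x
  depth-antitone (axis≤ _) = z≤n
  depth-antitone (line≤ _) = ℕₚ.≤-refl
  depth-antitone (up a)    = ℕₚ.m≤n⇒m≤1+n (depth-antitone a)

  ⊑⇒¬deeper : ∀ {x y} → x ⊑ y → ¬ depth x ℕ.< depth y
  ⊑⇒¬deeper x⊑y x<y = ℕₚ.<⇒≱ x<y (depth-antitone x⊑y)

  ⊑-antisym : ∀ {x y} → x ⊑ y → y ⊑ x → x ≡ y
  ⊑-antisym (axis≤ a) (axis≤ b) = cong onAxis (AT.antisym a b)
  ⊑-antisym (line≤ a) (line≤ b) = cong (onLine _ _) (WT.antisym _ a b)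
  ⊑-antisym (line≤ _) (up b)    = ⊥-elim (⊑⇒¬deeper b ℕₚ.≤-refl)
  ⊑-antisym (up a)    b         = ⊥-elim (⊑⇒¬deeper a (depth-antitone b))

  sameLine-⊑-total : ∀ {x y} → line x ≡ line y → x ⊑ y ⊎ y ⊑ x
  sameLine-⊑-total {onAxis v} {onAxis v'} _ with AT.total v v'
  ... | inj₁ h = inj₁ (axis≤ h)
  ... | inj₂ h = inj₂ (axis≤ h)
  sameLine-⊑-total {onLine p e v} {onLine .p .e v'} refl with WT.total _ v v'
  ... | inj₁ h = inj₁ (line≤ h)
  ... | inj₂ h = inj₂ (line≤ h)

  ⊑-upLinear : ∀ {x y z} → x ⊑ y → x ⊑ z → y ⊑ z ⊎ z ⊑ y
  ⊑-upLinear (axis≤ _) (axis≤ _) = sameLine-⊑-total refl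
  ⊑-upLinear (line≤ _) (line≤ _) = sameLine-⊑-total refl
  ⊑-upLinear (line≤ _) (up b)    = inj₁ (up b)
  ⊑-upLinear (up a)    (line≤ _) = inj₂ (up a)
  ⊑-upLinear (up a)    (up b)    = ⊑-upLinear a b

  encode : Node → ℕ
  encode (onAxis v)     = pair 0 (Injection.to A.countable v)
  encode (onLine p e v) =
    pair 1 (pair (encode p) (pair (Injection.to (M.countable (label p)) e)
                                  (Injection.to (W.countable (M.lab (label p) e)) v)))

  encode-injective : ∀ {x y} → encode x ≡ encode y → x ≡ y
  encode-injective {onAxis v} {onAxis v'} eq =
    cong onAxis (Injection.injective A.countable (proj₂ (pair-injective eq)))
  encode-injective {onAxis _} {onLine _ _ _} eq with () ← proj₁ (pair-injective eq)
  encode-injective {onLine _ _ _} {onAxis _} eq with () ← proj₁ (pair-injective eq)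
  encode-injective {onLine p e v} {onLine p' e' v'} eq
    with pair-injective (proj₂ (pair-injective eq))
  ... | p≡p' , ev≡e'v'
    with refl ← encode-injective {p} {p'} p≡p'
    with refl ← Injection.injective (M.countable (label p)) {e} {e'}
                  (proj₁ (pair-injective ev≡e'v'))
    with refl ← Injection.injective (W.countable (M.lab (label p) e)) {v} {v'}
                  (proj₂ (pair-injective ev≡e'v'))
    = refl

  Node-countable : Countable Node
  Node-countable = mk↣ encode-injective

  someNode : (U : Line) → Σ Node λ x → line x ≡ just U
  someNode (p , e) = onLine p e (proj₂ nonempty-arrangements (label p) e) , refl

  Line-countable : Countable Line
  Line-countable = mk↣ {to = encode ∘ proj₁ ∘ someNode}
    λ {U} {U'} eq → just-injective (trans (sym (proj₂ (someNode U)))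
                                   (trans (cong line (encode-injective eq)) (proj₂ (someNode U'))))

  _≟Line_ : (U U' : Line) → Dec (U ≡ U')
  _≟Line_ = ℕₚ.eq? Line-countable

  -- Joins: lift the deeper node to the top of its line until both are on a common line.

  Join : Node → Node → Set
  Join x y = Σ Node λ j → x ⊑ j × y ⊑ j × (∀ z → x ⊑ z → y ⊑ z → j ⊑ z)

  parent⊑ : ∀ {p e v x z} → onLine p e v ⊑ z → x ⊑ z → depth x ℕ.< suc (depth p) → p ⊑ z
  parent⊑ (line≤ _) x⊑z x<y = ⊥-elim (⊑⇒¬deeper x⊑z x<y)
  parent⊑ (up p⊑z)  _   _   = p⊑z

  cousin-parent⊑ : ∀ {p e v p' e' v' z} → _≢_ {A = Line} (p , e) (p' , e') → depth p ≡ depth p' →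
                   onLine p e v ⊑ z → onLine p' e' v' ⊑ z → p ⊑ z
  cousin-parent⊑ _         _    (up p⊑z)  _         = p⊑z
  cousin-parent⊑ different _    (line≤ _) (line≤ _) = ⊥-elim (different refl)
  cousin-parent⊑ _         same (line≤ _) (up p'⊑z) =
    ⊥-elim (⊑⇒¬deeper p'⊑z (s≤s (ℕₚ.≤-reflexive (sym same))))

  comparable-join : ∀ {x y} → x ⊑ y ⊎ y ⊑ x → Join x y
  comparable-join (inj₁ x⊑y) = _ , x⊑y , ⊑-refl , λ _ _ y⊑z → y⊑z
  comparable-join (inj₂ y⊑x) = _ , ⊑-refl , y⊑x , λ _ x⊑z _ → x⊑z

  join : ∀ x y → Join x y
  join x y with ℕₚ.<-cmp (depth x) (depth y)
  join x (onLine q f u) | tri< x<y _ _ with j , x⊑j , q⊑j , least ← join x q =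
    j , x⊑j , up q⊑j , λ z x⊑z y⊑z → least z x⊑z (parent⊑ y⊑z x⊑z x<y)
  join (onLine q f u) y | tri> _ _ y<x with j , q⊑j , y⊑j , least ← join q y =
    j , up q⊑j , y⊑j , λ z x⊑z y⊑z → least z (parent⊑ x⊑z y⊑z y<x) y⊑z
  join (onAxis _) (onAxis _) | tri≈ _ _ _ = comparable-join (sameLine-⊑-total refl)
  join (onLine p e _) (onLine p' e' _) | tri≈ _ _ _ with (p , e) ≟Line (p' , e')
  ... | yes refl = comparable-join (sameLine-⊑-total refl)
  join (onLine p e _) (onLine p' e' _) | tri≈ _ 1+d≡1+d' _ | no different
    with j , p⊑j , p'⊑j , least ← join p p' =
    j , up p⊑j , up p'⊑j , λ z x⊑z y⊑z →
      least z (cousin-parent⊑ different d≡d' x⊑z y⊑z)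
              (cousin-parent⊑ (different ∘ sym) (sym d≡d') y⊑z x⊑z)
    where
    d≡d' : depth p ≡ depth p'
    d≡d' = ℕₚ.suc-injective 1+d≡1+d'

  tree : JoinTree
  tree = record
    { N              = Node
    ; countable      = Node-countable
    ; _≤_            = _⊑_
    ; isPartialOrder = record
      { isPreorder = record
        { isEquivalence = isEquivalence
        ; reflexive     = λ { refl → ⊑-refl }
        ; trans         = ⊑-trans
        }
      ; antisym = ⊑-antisym
      }
    ; upLinear       = λ _ _ _ → ⊑-upLinear
    ; join           = join
    }

  line-convex : ∀ U x y z → line x ≡ U → line z ≡ U → x ⊑ y → y ⊑ z → line y ≡ U
  line-convex _ _ _ _ x∈U _ (axis≤ _) _ = x∈U
  line-convex _ _ _ _ x∈U _ (line≤ _) _ = x∈U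
  line-convex _ (onLine p e v) y (onLine .p .e u) refl refl (up p⊑y) y⊑z =
    ⊥-elim (⊑⇒¬deeper p⊑y (depth-antitone y⊑z))

  axis-upClosed : UpClosed tree (λ x → line x ≡ nothing)
  axis-upClosed (onAxis _) (onAxis _) _ (axis≤ _) = refl

  line-depth : ∀ {x p e} → line x ≡ just (p , e) → depth x ≡ suc (depth p)
  line-depth {onLine _ _ _} refl = refl

  line-notUpClosed : ∀ U → ¬ UpClosed tree (λ x → line x ≡ just U)
  line-notUpClosed U@(p , _) upClosed =
    ℕₚ.1+n≢n (sym (line-depth {p} (upClosed (proj₁ (someNode U)) p refl (up ⊑-refl))))

  line-top-isTop : ∀ U → IsTop tree (λ x → line x ≡ just U) (proj₁ U)
  line-top-isTop U@(p , e) = U-below-p , p-least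
    where
    U-below-p : ∀ y → line y ≡ just U → _<_ tree y p
    U-below-p (onLine _ _ _) refl = up ⊑-refl , ℕₚ.1+n≢n ∘ cong depth
    p-least : ∀ t → (∀ y → line y ≡ just U → _<_ tree y t) → p ⊑ t
    p-least t U-below-t with U-below-t (proj₁ (someNode U)) refl
    ... | up p⊑t , _ = p⊑t
    ... | line≤ {v' = u} _ , _ = ⊥-elim (proj₂ (U-below-t (onLine p e u) refl) refl)

  reachesAxis : ∀ x → ReachesAxis tree line x
  reachesAxis (onAxis _)     = here refl
  reachesAxis (onLine p e _) = step refl (line-top-isTop (p , e)) (reachesAxis p)

  canonical : SJTree
  canonical = record
    { tree        = tree
    ; structuring = record
      { L           = Line
      ; countableL  = Line-countable
      ; line        = line
      ; nonempty    = λ { nothing  → onAxis (proj₁ nonempty-arrangements) , refl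
                        ; (just U) → someNode U }
      ; linear      = λ _ x y x∈U y∈U → sameLine-⊑-total (trans x∈U (sym y∈U))
      ; convex      = line-convex
      ; axis-up     = axis-upClosed
      ; axis-unique = line-notUpClosed
      ; top         = proj₁
      ; top-isTop   = line-top-isTop
      ; finite      = reachesAxis
      }
    }

  axisPosition : Σ Node (λ x → line x ≡ nothing) → A.V
  axisPosition (onAxis v , _) = v

  axis≅ : SubArrIso Node _⊑_ (λ x → line x ≡ nothing) label wAx
  axis≅ = mk↔ₛ′ axisPosition (λ v → onAxis v , refl) (λ _ → refl) (λ { (onAxis _ , refl) → refl })
        , (λ { (onAxis _ , refl) (onAxis _ , refl) → (λ { (axis≤ h) → h }) , axis≤ })
        , (λ { (onAxis _ , refl) → refl })

  linePosition : ∀ U → Σ Node (λ x → line x ≡ just U) → W.V (lineLabel U)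
  linePosition _ (onLine _ _ v , refl) = v

  line≅ : ∀ U → SubArrIso Node _⊑_ (λ x → line x ≡ just U) label (w (lineLabel U))
  line≅ U@(p , e) =
      mk↔ₛ′ (linePosition U) (λ v → onLine p e v , refl) (λ _ → refl)
            (λ { (onLine _ _ _ , refl) → refl })
    , (λ { (onLine _ _ _ , refl) (onLine _ _ _ , refl) → position-≤ , line≤ })
    , (λ { (onLine _ _ _ , refl) → refl })
    where
    position-≤ : ∀ {v v'} → onLine p e v ⊑ onLine p e v' → W._≤_ (lineLabel U) v v'
    position-≤ (line≤ h) = h
    position-≤ (up h)    = ⊥-elim (⊑⇒¬deeper h ℕₚ.≤-refl)

  lineName : ∀ x → Σ Line (λ U → proj₁ U ≡ x) → M.M (label x)
  lineName _ ((_ , e) , refl) = e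

  tops≅ : ∀ x → LabIso (Σ Line λ U → proj₁ U ≡ x) (lineLabel ∘ proj₁) (m (label x))
  tops≅ x = mk↔ₛ′ (lineName x) (λ e → (x , e) , refl) (λ _ → refl) (λ { (_ , refl) → refl })
          , (λ { (_ , refl) → refl })

  canonical-describes : Describes Δ canonical
  canonical-describes = label , lineLabel , axis≅ , tops≅ , line≅

module Described (Δ : SJScheme) (nonempty-arrangements : NonemptyArrangements Δ)
                 (S : SJTree) (desc : Describes Δ S) where
  open SJScheme Δ
  open CanonicalTree Δ nonempty-arrangements
  private
    module S = SJTree S
    module S≤ = IsPartialOrder S.isPartialOrder

  r : S.N → Q
  r = proj₁ desc

  r̃ : S.L → D
  r̃ = proj₁ (proj₂ desc)

  module Axis = SubArrIsoEnumeration {w = wAx} (proj₁ (proj₂ (proj₂ desc)))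
  module Tops (x : S.N) = LabIsoEnumeration {m = m (r x)} (proj₁ (proj₂ (proj₂ (proj₂ desc))) x)
  module OfLine (U : S.L) =
    SubArrIsoEnumeration {w = w (r̃ U)} (proj₂ (proj₂ (proj₂ (proj₂ desc))) U)

  -- The label index is generalised so that φ below can use the label of a canonical node,
  -- which equals the label of its image only propositionally.

  lineWithTop : (x : S.N) {q : Q} → r x ≡ q → M.M q → S.L
  lineWithTop x refl = Tops.elem x

  lineWithTop-top : ∀ x {q} (eq : r x ≡ q) e → S.top (lineWithTop x eq e) ≡ x
  lineWithTop-top x refl = Tops.elem-∈ x

  lineWithTop-label : ∀ x {q} (eq : r x ≡ q) e → r̃ (lineWithTop x eq e) ≡ M.lab q e
  lineWithTop-label x refl = Tops.elem-label x

  lineWithTop-injective : ∀ x {q} (eq : r x ≡ q) {e e'} →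
                          lineWithTop x eq e ≡ lineWithTop x eq e' → e ≡ e'
  lineWithTop-injective x refl = Tops.elem-injective x

  lineWithTop-surjective : ∀ x {q} (eq : r x ≡ q) {U} → S.top U ≡ x →
                           Σ (M.M q) λ e → lineWithTop x eq e ≡ U
  lineWithTop-surjective x refl = Tops.elem-surjective x

  nodeOn : (U : S.L) {d : D} → r̃ U ≡ d → W.V d → S.N
  nodeOn U refl = OfLine.elem U

  nodeOn-line : ∀ U {d} (eq : r̃ U ≡ d) v → S.line (nodeOn U eq v) ≡ just U
  nodeOn-line U refl = OfLine.elem-∈ U

  nodeOn-label : ∀ U {d} (eq : r̃ U ≡ d) v → r (nodeOn U eq v) ≡ W.lab d v
  nodeOn-label U refl = OfLine.elem-label U

  nodeOn-≤ : ∀ U {d} (eq : r̃ U ≡ d) v v' →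
             (nodeOn U eq v S.≤ nodeOn U eq v' → W._≤_ d v v')
             × (W._≤_ d v v' → nodeOn U eq v S.≤ nodeOn U eq v')
  nodeOn-≤ U refl = OfLine.elem-≤ U

  nodeOn-injective : ∀ U {d} (eq : r̃ U ≡ d) {v v'} → nodeOn U eq v ≡ nodeOn U eq v' → v ≡ v'
  nodeOn-injective U refl = OfLine.elem-injective U

  nodeOn-surjective : ∀ U {d} (eq : r̃ U ≡ d) {y} → S.line y ≡ just U →
                      Σ (W.V d) λ v → nodeOn U eq v ≡ y
  nodeOn-surjective U refl = OfLine.elem-surjective U

  mutual
    φ : Node → S.N
    φ (onAxis v)     = Axis.elem v
    φ (onLine p e v) = nodeOn (φL p e) (φL-label p e) v

    φ-label : ∀ x → r (φ x) ≡ label x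
    φ-label (onAxis v)     = Axis.elem-label v
    φ-label (onLine p e v) = nodeOn-label (φL p e) (φL-label p e) v

    φL : (p : Node) → M.M (label p) → S.L
    φL p = lineWithTop (φ p) (φ-label p)

    φL-label : ∀ p e → r̃ (φL p e) ≡ M.lab (label p) e
    φL-label p = lineWithTop-label (φ p) (φ-label p)

  φL-top : ∀ p e → S.top (φL p e) ≡ φ p
  φL-top p = lineWithTop-top (φ p) (φ-label p)

  φ-line : Maybe Line → Maybe S.L
  φ-line nothing        = nothing
  φ-line (just (p , e)) = just (φL p e)

  line-φ : ∀ x → S.line (φ x) ≡ φ-line (line x)
  line-φ (onAxis v)     = Axis.elem-∈ v
  line-φ (onLine p e v) = nodeOn-line (φL p e) (φL-label p e) v

  sameLine-φ : ∀ x y → S.line (φ x) ≡ S.line (φ y) → φ-line (line x) ≡ φ-line (line y)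
  sameLine-φ x y h = trans (sym (line-φ x)) (trans h (line-φ y))

  mutual
    φL-injective : ∀ p e p' e' → φL p e ≡ φL p' e' → _≡_ {A = Line} (p , e) (p' , e')
    φL-injective p e p' e' h
      with refl ← φ-injective {p} {p'}
                    (trans (sym (φL-top p e)) (trans (cong S.top h) (φL-top p' e')))
      with refl ← lineWithTop-injective (φ p) (φ-label p) h
      = refl

    φ-injective : ∀ {x y} → φ x ≡ φ y → x ≡ y
    φ-injective {onAxis _} {onAxis _} h = cong onAxis (Axis.elem-injective h)
    φ-injective {x@(onAxis _)} {y@(onLine _ _ _)} h with () ← sameLine-φ x y (cong S.line h)
    φ-injective {x@(onLine _ _ _)} {y@(onAxis _)} h with () ← sameLine-φ x y (cong S.line h)
    φ-injective {x@(onLine p e _)} {y@(onLine p' e' _)} h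
      with refl ← φL-injective p e p' e' (just-injective (sameLine-φ x y (cong S.line h)))
      = cong (onLine p e) (nodeOn-injective (φL p e) (φL-label p e) h)

  φ-line-injective : ∀ U U' → φ-line U ≡ φ-line U' → U ≡ U'
  φ-line-injective nothing        nothing          _ = refl
  φ-line-injective (just (p , e)) (just (p' , e')) h =
    cong just (φL-injective p e p' e' (just-injective h))

  φ-surjective : ∀ y → ReachesAxis S.tree S.line y → Σ Node λ x → φ x ≡ y
  φ-surjective y (here y∈axis) with v , φv≡y ← Axis.elem-surjective y∈axis = onAxis v , φv≡y
  φ-surjective y (step {t = t} {U = U} y∈U t-top t-reaches)
    with p , φp≡t ← φ-surjective t t-reaches
    with e , φLpe≡U ← lineWithTop-surjective (φ p) (φ-label p)
                        (trans (top-unique S.tree (S.top-isTop U) t-top) (sym φp≡t))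
    with v , φx≡y ← nodeOn-surjective (φL p e) (φL-label p e)
                      (subst (λ U' → S.line y ≡ just U') (sym φLpe≡U) y∈U)
    = onLine p e v , φx≡y

  φ-↔ : Node ↔ S.N
  φ-↔ = mk↔ₛ′ φ preimage (λ y → proj₂ (φ-surjective y (S.finite y)))
               (λ x → φ-injective (proj₂ (φ-surjective (φ x) (S.finite (φ x)))))
    where
    preimage : S.N → Node
    preimage y = proj₁ (φ-surjective y (S.finite y))

  φ-below-top : ∀ p e v → φ (onLine p e v) S.≤ φ p
  φ-below-top p e v =
    subst (φ (onLine p e v) S.≤_) (φL-top p e)
          (proj₁ (proj₁ (S.top-isTop (φL p e)) _ (line-φ (onLine p e v))))

  φ-monotone : ∀ {x y} → x ⊑ y → φ x S.≤ φ y
  φ-monotone (axis≤ {v} {v'} h)         = proj₂ (Axis.elem-≤ v v') h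
  φ-monotone (line≤ {p} {e} {v} {v'} h) = proj₂ (nodeOn-≤ (φL p e) (φL-label p e) v v') h
  φ-monotone (up {p} {e} {v} h)         = S≤.trans (φ-below-top p e v) (φ-monotone h)

  φ-reflects : ∀ x y → φ x S.≤ φ y → x ⊑ y
  φ-reflects (onAxis v) (onAxis v') h = axis≤ (proj₁ (Axis.elem-≤ v v') h)
  φ-reflects (onAxis v) y@(onLine _ _ _) h
    with () ← trans (sym (S.axis-up _ _ (line-φ (onAxis v)) h)) (line-φ y)
  φ-reflects x@(onLine _ _ _) y h with ≤-sameLine-or-top≤ S (φ x) (φ y) h
  φ-reflects x@(onLine _ _ _) y@(onAxis _) h | inj₁ same
    with () ← φ-line-injective (line x) (line y) (sameLine-φ x y same)
  φ-reflects x@(onLine p e v) y@(onLine _ _ v') h | inj₁ same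
    with refl ← φ-line-injective (line x) (line y) (sameLine-φ x y same)
    = line≤ (proj₁ (nodeOn-≤ (φL p e) (φL-label p e) v v') h)
  φ-reflects x@(onLine p e v) y h | inj₂ (U , φx∈U , top≤φy) =
    up (φ-reflects p y (subst (S._≤ φ y) top-U≡φp top≤φy))
    where
    top-U≡φp : S.top U ≡ φ p
    top-U≡φp = trans (cong S.top (just-injective (trans (sym φx∈U) (line-φ x)))) (φL-top p e)

  canonical≅ : SJIso canonical S
  canonical≅ =
      φ-↔
    , (λ x y → φ-monotone , φ-reflects x y)
    , (λ x y → (λ h → trans (line-φ x) (trans (cong φ-line h) (sym (line-φ y))))
             , (φ-line-injective (line x) (line y) ∘ sameLine-φ x y))

proposition3p24 :
  ((S : SJTree) → Σ SJScheme λ Δ → Describes Δ S)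
  × ((Δ : SJScheme) → NonemptyArrangements Δ →
       Σ SJTree (Describes Δ)
       × ((S S' : SJTree) → Describes Δ S → Describes Δ S' → SJIso S S'))
proposition3p24 = own-scheme , λ Δ ne → canonical-tree Δ ne , isomorphic Δ ne
  where
  own-scheme : (S : SJTree) → Σ SJScheme λ Δ → Describes Δ S
  own-scheme S = OwnScheme.scheme S , OwnScheme.describes S

  canonical-tree : (Δ : SJScheme) → NonemptyArrangements Δ → Σ SJTree (Describes Δ)
  canonical-tree Δ ne = CanonicalTree.canonical Δ ne , CanonicalTree.canonical-describes Δ ne

  isomorphic : (Δ : SJScheme) (ne : NonemptyArrangements Δ) (S S' : SJTree) →
               Describes Δ S → Describes Δ S' → SJIso S S'
  isomorphic Δ ne S S' d d' =
    SJIso-trans S (CanonicalTree.canonical Δ ne) S'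
      (SJIso-sym (CanonicalTree.canonical Δ ne) S (Described.canonical≅ Δ ne S d))
      (Described.canonical≅ Δ ne S' d')
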